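{- Let $n=2m>3$ be an even integer and let $a,b$ be natural numbers with $1\le a<b\le n-1$. For $i=1,\ldots,n$ let $s_i$ be the sum of the first $i$ entries of the $n$-tuple $(a,b,a,b,\ldots,a,b)$, i.e. $s_i=\frac{i+1}{2}a+\frac{i-1}{2}b$ for odd $i$ and $s_i=\frac{i}{2}(a+b)$ for even $i$. Then an equivalence class of $n$-polygons with $m$ axes is represented by the $n$-tuple $(a,b,a,b,\ldots,a,b)$ if and only if $s_i\not\equiv 0\pmod n$ for all $1\le i\le n-1$ and $s_n\equiv 0\pmod n$.
   Context: Fix $n\ge 3$ and the vertices $v_k=e^{2\pi i k/n}$, $k=0,\ldots,n-1$, on the unit circle. An $n$-polygon is a Hamiltonian cycle through these vertices: a closed path $v_{\sigma_1}\cdots v_{\sigma_n}v_{\sigma_1}$ of straight segments with $(\sigma_1,\ldots,\sigma_n)$ an ordering of $0,\ldots,n-1$. Its sides are the integers $e_i\in\{1,\ldots,n-1\}$ with $e_i\equiv\sigma_{i+1}-\sigma_i\pmod n$ ($\sigma_{n+1}=\sigma_1$); an $n$-tuple of sides represents a polygon if starting at a vertex and moving counterclockwise successively by the sides visits each vertex exactly once before returning to the start after the $n$-th step. Two $n$-polygons are equivalent if one is obtained from the other by a rotation about the center. An $n$-polygon with $m$ axes is one with exactly $m$ axes of reflection symmetry. -}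

module Defs where

open import Data.Nat using (ℕ; zero; suc; _+_; _∸_; _≤_; _<_; _<?_; NonZero)
open import Data.Nat.DivMod using (_%_)
open import Data.Fin using (Fin; toℕ; fromℕ<)
open import Data.Product using (Σ; ∃; _×_)
open import Data.Sum using (_⊎_)
open import Relation.Binary.PropositionalEquality using (_≡_)
open import Relation.Nullary using (yes; no)
open import Function.Bundles using (_⇔_)

-- k-th entry (0-based) of an n-tuple, extended by 0 outside the range
entry : ∀ {n} → (Fin n → ℕ) → ℕ → ℕ
entry {n} e k with k <? n
... | yes k<n = e (fromℕ< k<n)
... | no _    = 0

psum : ∀ {n} → (Fin n → ℕ) → ℕ → ℕ
psum e zero    = 0
psum e (suc k) = psum e k + entry e k

altEntry : ℕ → ℕ → ℕ → ℕ
altEntry a b zero          = a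
altEntry a b (suc zero)    = b
altEntry a b (suc (suc i)) = altEntry a b i

alt : (n : ℕ) → ℕ → ℕ → Fin n → ℕ
alt n a b i = altEntry a b (toℕ i)

module _ (n : ℕ) .{{_ : NonZero n}} (e : Fin n → ℕ) where

  -- index (in 0..n-1) of the vertex reached after k steps, starting at v_0
  vertex : ℕ → ℕ
  vertex k = psum {n} e k % n

  Represents : Set
  Represents =
    (∀ i → 1 ≤ e i × e i ≤ n ∸ 1) ×
    (∀ (i j : Fin n) → vertex (toℕ i) ≡ vertex (toℕ j) → i ≡ j) ×
    psum {n} e n % n ≡ 0

  -- the reflection of the vertex set v_x ↦ v_{c - x}
  reflect : ℕ → ℕ → ℕ
  reflect c x = (c + (n ∸ x)) % n

  SameEdge : ℕ → ℕ → ℕ → ℕ → Set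
  SameEdge x y u v = (x ≡ u × y ≡ v) ⊎ (x ≡ v × y ≡ u)

  IsAxis : Fin n → Set
  IsAxis c = ∀ (k : Fin n) → ∃ λ (k' : Fin n) →
    SameEdge (reflect (toℕ c) (vertex (toℕ k))) (reflect (toℕ c) (vertex (suc (toℕ k))))
             (vertex (toℕ k')) (vertex (suc (toℕ k')))

  -- exactly m axes: the axes are enumerated injectively by Fin m
  HasExactlyAxes : ℕ → Set
  HasExactlyAxes m = Σ (Fin m → Fin n) λ f →
    (∀ i j → f i ≡ f j → i ≡ j) × (∀ c → IsAxis c ⇔ ∃ λ j → f j ≡ c)

-- Write D = a + b. The vertex reached after k steps is s_k, and s_(2q) = q·D, s_(2q+1) = q·D + a.
-- The conditions say exactly that D has order m modulo n and that a ∉ ⟨D⟩ (mod n); then the even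
-- and the odd vertices are the two cosets ⟨D⟩ and a + ⟨D⟩, so the tuple is a polygon. The reflection
-- v_x ↦ v_(c-x) with c ≡ a + j·D maps every side onto a side with its orientation reversed, which gives
-- the m axes c ≡ s_(2j+1). Conversely an axis maps the side {0, a} to a side, which forces
-- c ≡ a + l·D, except possibly when 2a ≡ 0 and c ∈ ⟨D⟩; the image of the side {a, D} excludes that.
module Submission where

open import Defs
open import Data.Nat using (ℕ; zero; suc; _∸_; _≤_; _<_; z≤n; s≤s; NonZero)
import Data.Nat as ℕ
import Data.Nat.Properties as ℕₚ
open import Data.Nat.DivMod using (_%_; m<n⇒m%n≡m; m%n<n)
open import Data.Nat.Divisibility using (n∣m⇒m%n≡0)
open import Data.Integer using (ℤ; +_; 0ℤ; 1ℤ; ∣_∣; _%ℕ_; _/ℕ_)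
import Data.Integer as ℤ
import Data.Integer.Properties as ℤₚ
open import Data.Integer.DivMod using (a≡a%ℕn+[a/ℕn]*n; n%ℕd<d)
open import Data.Integer.Divisibility.Signed
  using (_∣_; divides; ∣⇒∣ᵤ; ∣m∣n⇒∣m+n; ∣m⇒∣-m; ∣n⇒∣m*n)
open import Data.Integer.Tactic.RingSolver using (solve)
open import Data.List using (_∷_; [])
open import Data.Product using (Σ; _×_; _,_; proj₁; proj₂; uncurry)
open import Data.Sum using (_⊎_; inj₁; inj₂; [_,_]′)
open import Data.Fin using (Fin; toℕ; fromℕ<)
open import Data.Fin.Properties using (toℕ-fromℕ<; toℕ<n; toℕ-injective)
open import Relation.Nullary using (¬_; yes; no; contradiction)
open import Data.Empty using (⊥; ⊥-elim)
open import Relation.Binary.Bundles using (Setoid)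
open import Relation.Binary.PropositionalEquality
  using (_≡_; _≢_; refl; sym; trans; cong; cong₂; subst; module ≡-Reasoning)
open import Function.Bundles using (_⇔_; mk⇔)
import Relation.Binary.Reasoning.Setoid as SetoidReasoning

infix 4 _≡_mod_

record _≡_mod_ (x y : ℤ) (n : ℕ) : Set where
  constructor modulo
  field divides-difference : + n ∣ x ℤ.- y

module _ where
  open import Data.Integer using (_+_; _-_; -_)

  x-[x+y]≡-y : ∀ x y → x - (x + y) ≡ - y
  x-[x+y]≡-y x y = solve (x ∷ y ∷ [])

  [x+y]-x≡y : ∀ x y → (x + y) - x ≡ y
  [x+y]-x≡y x y = solve (x ∷ y ∷ [])

  [x+y]-[x+z]≡y-z : ∀ x y z → (x + y) - (x + z) ≡ y - z
  [x+y]-[x+z]≡y-z x y z = solve (x ∷ y ∷ z ∷ [])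

  [x-y]-[x-z]≡z-y : ∀ x y z → (x - y) - (x - z) ≡ z - y
  [x-y]-[x-z]≡z-y x y z = solve (x ∷ y ∷ z ∷ [])

module _ {n : ℕ} where
  open import Data.Integer using (_+_; _-_; _*_; -_)

  private
    ∣-resp-≡ : ∀ {x y} → + n ∣ x → x ≡ y → + n ∣ y
    ∣-resp-≡ n∣x refl = n∣x

  ≡mod-reflexive : ∀ {x y} → x ≡ y → x ≡ y mod n
  ≡mod-reflexive {x} refl = modulo (∣-resp-≡ (divides 0ℤ refl) (sym (ℤₚ.+-inverseʳ x)))

  ≡mod-refl : ∀ {x} → x ≡ x mod n
  ≡mod-refl = ≡mod-reflexive refl

  ≡mod-sym : ∀ {x y} → x ≡ y mod n → y ≡ x mod n
  ≡mod-sym {x} {y} (modulo d) = modulo (∣-resp-≡ (∣m⇒∣-m d) (solve (x ∷ y ∷ [])))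

  ≡mod-trans : ∀ {x y z} → x ≡ y mod n → y ≡ z mod n → x ≡ z mod n
  ≡mod-trans {x} {y} {z} (modulo d) (modulo e) =
    modulo (∣-resp-≡ (∣m∣n⇒∣m+n d e) (solve (x ∷ y ∷ z ∷ [])))

  ≡mod-setoid : Setoid _ _
  ≡mod-setoid = record
    { Carrier = ℤ
    ; _≈_ = _≡_mod n
    ; isEquivalence = record { refl = ≡mod-refl ; sym = ≡mod-sym ; trans = ≡mod-trans }
    }

  +-cong-mod : ∀ {x x′ y y′} → x ≡ x′ mod n → y ≡ y′ mod n → x + y ≡ x′ + y′ mod n
  +-cong-mod {x} {x′} {y} {y′} (modulo d) (modulo e) =
    modulo (∣-resp-≡ (∣m∣n⇒∣m+n d e) (solve (x ∷ x′ ∷ y ∷ y′ ∷ [])))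

  neg-cong-mod : ∀ {x y} → x ≡ y mod n → - x ≡ - y mod n
  neg-cong-mod {x} {y} (modulo d) = modulo (∣-resp-≡ (∣m⇒∣-m d) (solve (x ∷ y ∷ [])))

  -‿cong-mod : ∀ {x x′ y y′} → x ≡ x′ mod n → y ≡ y′ mod n → x - y ≡ x′ - y′ mod n
  -‿cong-mod x≡x′ y≡y′ = +-cong-mod x≡x′ (neg-cong-mod y≡y′)

  ≡mod-scale : ∀ {m d k k′} → + m * d ≡ 0ℤ mod n → k ≡ k′ mod m → k * d ≡ k′ * d mod n
  ≡mod-scale {m} {d} {k} {k′} (modulo n∣md) (modulo (divides q k-k′≡qm)) =
    modulo (∣-resp-≡ (∣n⇒∣m*n q n∣md) (begin
      q * (+ m * d - 0ℤ)  ≡⟨ reassociate q (+ m) d ⟩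
      q * + m * d         ≡⟨ cong (_* d) k-k′≡qm ⟨
      (k - k′) * d        ≡⟨ distribute k k′ d ⟩
      k * d - k′ * d      ∎))
    where
    open ≡-Reasoning
    reassociate : ∀ q M d → q * (M * d - 0ℤ) ≡ q * M * d
    reassociate q M d = solve (q ∷ M ∷ d ∷ [])
    distribute : ∀ k k′ d → (k - k′) * d ≡ k * d - k′ * d
    distribute k k′ d = solve (k ∷ k′ ∷ d ∷ [])

  x≡y⇒x-y≡0-mod : ∀ {x y} → x ≡ y mod n → x - y ≡ 0ℤ mod n
  x≡y⇒x-y≡0-mod {x} {y} (modulo d) = modulo (∣-resp-≡ d (solve (x ∷ y ∷ [])))

  x-y≡0⇒x≡y-mod : ∀ {x y} → x - y ≡ 0ℤ mod n → x ≡ y mod n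
  x-y≡0⇒x≡y-mod {x} {y} (modulo d) = modulo (∣-resp-≡ d (solve (x ∷ y ∷ [])))

  +-cancelʳ-mod : ∀ {x y} z → x + z ≡ y + z mod n → x ≡ y mod n
  +-cancelʳ-mod {x} {y} z (modulo d) = modulo (∣-resp-≡ d (solve (x ∷ y ∷ z ∷ [])))

  n≡0-mod : + n ≡ 0ℤ mod n
  n≡0-mod = modulo (divides 1ℤ (trans (ℤₚ.+-identityʳ (+ n)) (sym (ℤₚ.*-identityˡ (+ n)))))

  x≡-x⇒x+x≡0-mod : ∀ {x} → x ≡ - x mod n → x + x ≡ 0ℤ mod n
  x≡-x⇒x+x≡0-mod {x} (modulo d) = modulo (∣-resp-≡ d (solve (x ∷ [])))

  x+x≡0⇒x≡-x-mod : ∀ {x} → x + x ≡ 0ℤ mod n → x ≡ - x mod n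
  x+x≡0⇒x≡-x-mod {x} (modulo d) = modulo (∣-resp-≡ d (solve (x ∷ [])))

  module _ .{{_ : NonZero n}} where

    %ℕ-≡mod : ∀ k → + (k %ℕ n) ≡ k mod n
    %ℕ-≡mod k = modulo (divides (- (k /ℕ n))
      (trans (cong (_-_ (+ (k %ℕ n))) (a≡a%ℕn+[a/ℕn]*n k n)) (cancel (+ (k %ℕ n)) (k /ℕ n) (+ n))))
      where
      cancel : ∀ r q N → r - (r + q * N) ≡ - q * N
      cancel r q N = solve (r ∷ q ∷ N ∷ [])

    %-≡mod : ∀ k → + (k % n) ≡ + k mod n
    %-≡mod k = %ℕ-≡mod (+ k)

    ≡mod⇒≡ : ∀ {x y} → x < n → y < n → + x ≡ + y mod n → x ≡ y
    ≡mod⇒≡ {x} {y} x<n y<n (modulo n∣x-y) =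
      ℤₚ.+-injective (ℤₚ.i-j≡0⇒i≡j (+ x) (+ y) (ℤₚ.∣i∣≡0⇒i≡0 ∣x-y∣≡0))
      where
      ∣x-y∣<n : ∣ + x - + y ∣ < n
      ∣x-y∣<n = subst (_< n) (cong ∣_∣ (sym (ℤₚ.m-n≡m⊖n x y)))
                  (ℕₚ.≤-<-trans (ℤₚ.∣m⊝n∣≤m⊔n x y) (ℕₚ.⊔-lub x<n y<n))
      ∣x-y∣≡0 : ∣ + x - + y ∣ ≡ 0
      ∣x-y∣≡0 = trans (sym (m<n⇒m%n≡m ∣x-y∣<n)) (n∣m⇒m%n≡0 _ n (∣⇒∣ᵤ n∣x-y))

    x+x≡0-mod⇒x+x≡n : ∀ {x} → 0 < x → x < n → + x + + x ≡ 0ℤ mod n → x ℕ.+ x ≡ n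
    x+x≡0-mod⇒x+x≡n {x} 0<x x<n 2x≡0 = begin
      x ℕ.+ x        ≡⟨ cong (ℕ._+ x) (≡mod⇒≡ x<n (ℕₚ.∸-monoʳ-< 0<x (ℕₚ.<⇒≤ x<n)) x≡n-x) ⟩
      n ∸ x ℕ.+ x    ≡⟨ ℕₚ.m∸n+n≡m (ℕₚ.<⇒≤ x<n) ⟩
      n              ∎
      where
      open ≡-Reasoning
      x≡n-x : + x ≡ + (n ∸ x) mod n
      x≡n-x = +-cancelʳ-mod (+ x)
        (≡mod-trans 2x≡0 (≡mod-trans (≡mod-sym n≡0-mod) (≡mod-reflexive (begin
          + n                  ≡⟨ cong +_ (ℕₚ.m∸n+n≡m (ℕₚ.<⇒≤ x<n)) ⟨
          + (n ∸ x ℕ.+ x)      ≡⟨ ℤₚ.pos-+ (n ∸ x) x ⟩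
          + (n ∸ x) + + x      ∎))))

module ≡mod-Reasoning (n : ℕ) = SetoidReasoning (≡mod-setoid {n})

double : ℕ → ℕ
double zero    = zero
double (suc q) = suc (suc (double q))

double≡2* : ∀ q → double q ≡ 2 ℕ.* q
double≡2* zero    = refl
double≡2* (suc q) = trans (cong (λ k → suc (suc k)) (double≡2* q)) (sym (ℕₚ.*-suc 2 q))

double-nonZero : ∀ m .{{_ : NonZero m}} → NonZero (double m)
double-nonZero (suc m) = _

double-nonZero⁻¹ : ∀ m .{{_ : NonZero (double m)}} → NonZero m
double-nonZero⁻¹ (suc m) = _

double-mono-< : ∀ {p q} → p < q → suc (double p) < double q
double-mono-< {zero}  {suc q} _         = s≤s (s≤s z≤n)
double-mono-< {suc p} {suc q} (s≤s p<q) = s≤s (s≤s (double-mono-< p<q))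

double-cancel-< : ∀ {p q} → double p < double q → p < q
double-cancel-< {zero}  {suc q} _                 = s≤s z≤n
double-cancel-< {suc p} {suc q} (s≤s (s≤s 2p<2q)) = s≤s (double-cancel-< 2p<2q)

double-injective : ∀ {p q} → double p ≡ double q → p ≡ q
double-injective {zero}  {zero}  _  = refl
double-injective {suc p} {suc q} eq = cong suc (double-injective (ℕₚ.suc-injective (ℕₚ.suc-injective eq)))

data Parity : ℕ → Set where
  even : ∀ q → Parity (double q)
  odd  : ∀ q → Parity (suc (double q))

parity : ∀ k → Parity k
parity zero = even zero
parity (suc k) with parity k
... | even q = odd q
... | odd q  = even (suc q)

altEntry-elim : ∀ (P : ℕ → Set) {a b} → P a → P b → ∀ k → P (altEntry a b k)
altEntry-elim P pa pb zero          = pa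
altEntry-elim P pa pb (suc zero)    = pb
altEntry-elim P pa pb (suc (suc k)) = altEntry-elim P pa pb k

altEntry-even : ∀ a b q → altEntry a b (double q) ≡ a
altEntry-even a b zero    = refl
altEntry-even a b (suc q) = altEntry-even a b q

altEntry-odd : ∀ a b q → altEntry a b (suc (double q)) ≡ b
altEntry-odd a b zero    = refl
altEntry-odd a b (suc q) = altEntry-odd a b q

<⇒≤∸1 : ∀ {i n} → i < n → i ≤ n ∸ 1
<⇒≤∸1 (s≤s i≤n) = i≤n

≤∸1⇒< : ∀ {i n} → .{{_ : NonZero n}} → i ≤ n ∸ 1 → i < n
≤∸1⇒< {n = suc n} i≤n = s≤s i≤n

module _ (n : ℕ) .{{_ : NonZero n}} (e : Fin n → ℕ) where
  open import Data.Integer using (_+_; _-_)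

  FirstReturnAtEnd : Set
  FirstReturnAtEnd = (∀ i → 1 ≤ i → i ≤ n ∸ 1 → vertex n e i ≢ 0) × vertex n e n ≡ 0

  vertex<n : ∀ k → vertex n e k < n
  vertex<n k = m%n<n (psum e k) n

  represents⇒firstReturnAtEnd : Represents n e → FirstReturnAtEnd
  represents⇒firstReturnAtEnd (_ , injective , closed) = returns-late , closed
    where
    0<n = ℕ.>-nonZero⁻¹ n
    returns-late : ∀ i → 1 ≤ i → i ≤ n ∸ 1 → vertex n e i ≢ 0
    returns-late i 1≤i i≤n-1 vᵢ≡0 = ℕₚ.<⇒≢ 1≤i (sym (begin
      i                              ≡⟨ toℕ-fromℕ< i<n ⟨
      toℕ (fromℕ< i<n)               ≡⟨ cong toℕ (injective (fromℕ< i<n) (fromℕ< 0<n) same-vertex) ⟩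
      toℕ (fromℕ< 0<n)               ≡⟨ toℕ-fromℕ< 0<n ⟩
      0                              ∎))
      where
      open ≡-Reasoning
      i<n = ≤∸1⇒< i≤n-1
      same-vertex : vertex n e (toℕ (fromℕ< i<n)) ≡ vertex n e (toℕ (fromℕ< 0<n))
      same-vertex = begin
        vertex n e (toℕ (fromℕ< i<n))   ≡⟨ cong (vertex n e) (toℕ-fromℕ< i<n) ⟩
        vertex n e i                    ≡⟨ vᵢ≡0 ⟩
        0                               ≡⟨ m<n⇒m%n≡m 0<n ⟨
        vertex n e 0                    ≡⟨ cong (vertex n e) (toℕ-fromℕ< 0<n) ⟨
        vertex n e (toℕ (fromℕ< 0<n))   ∎

  reflect<n : ∀ c x → reflect n e c x < n
  reflect<n c x = m%n<n (c ℕ.+ (n ∸ x)) n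

  reflect-≡mod : ∀ c {x} → x ≤ n → + reflect n e c x ≡ + c - + x mod n
  reflect-≡mod c {x} x≤n = begin
    + reflect n e c x         ≈⟨ %-≡mod (c ℕ.+ (n ∸ x)) ⟩
    + (c ℕ.+ (n ∸ x))         ≡⟨ ℤₚ.pos-+ c (n ∸ x) ⟩
    + c + + (n ∸ x)           ≡⟨ cong (_+_ (+ c)) n-x ⟩
    + c + (+ n - + x)         ≈⟨ +-cong-mod (≡mod-refl {x = + c}) (-‿cong-mod n≡0-mod (≡mod-refl {x = + x})) ⟩
    + c + (0ℤ - + x)          ≡⟨ cong (_+_ (+ c)) (ℤₚ.+-identityˡ (ℤ.- + x)) ⟩
    + c - + x                 ∎
    where
    open ≡mod-Reasoning n
    n-x : + (n ∸ x) ≡ + n - + x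
    n-x = sym (trans (ℤₚ.m-n≡m⊖n n x) (ℤₚ.⊖-≥ x≤n))

  sameEdge-≡mod : ∀ {x y u v X Y U W} → SameEdge n e x y u v →
    + x ≡ X mod n → + y ≡ Y mod n → + u ≡ U mod n → + v ≡ W mod n →
    (X ≡ U mod n × Y ≡ W mod n) ⊎ (X ≡ W mod n × Y ≡ U mod n)
  sameEdge-≡mod (inj₁ (refl , refl)) x≡X y≡Y u≡U v≡W =
    inj₁ (≡mod-trans (≡mod-sym x≡X) u≡U , ≡mod-trans (≡mod-sym y≡Y) v≡W)
  sameEdge-≡mod (inj₂ (refl , refl)) x≡X y≡Y u≡U v≡W =
    inj₂ (≡mod-trans (≡mod-sym x≡X) v≡W , ≡mod-trans (≡mod-sym y≡Y) u≡U)

  MirrorsSide : ℕ → ℕ → ℕ → Set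
  MirrorsSide c k k′ = SameEdge n e (reflect n e c (vertex n e k)) (reflect n e c (vertex n e (suc k)))
                                    (vertex n e k′) (vertex n e (suc k′))

  axis-at : ∀ {c} → IsAxis n e c → ∀ {k} → k < n → Σ (Fin n) λ k′ → MirrorsSide (toℕ c) k (toℕ k′)
  axis-at {c} axis k<n =
    subst (λ k → Σ (Fin n) λ k′ → MirrorsSide (toℕ c) k (toℕ k′)) (toℕ-fromℕ< k<n) (axis (fromℕ< k<n))

  sameEdge-reversed : ∀ {x y u v} → x < n → y < n → u < n → v < n →
    + x ≡ + v mod n → + y ≡ + u mod n → SameEdge n e x y u v
  sameEdge-reversed x<n y<n u<n v<n x≡v y≡u = inj₂ (≡mod⇒≡ x<n v<n x≡v , ≡mod⇒≡ y<n u<n y≡u)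

module AlternatingPolygon (m : ℕ) .{{_ : NonZero m}} (a b : ℕ)
                          (1≤a : 1 ≤ a) (a<b : a < b) (b≤n-1 : b ≤ double m ∸ 1) where
  open import Data.Integer using (_+_; _-_; _*_; -_)

  n : ℕ
  n = double m

  instance
    n-nonZero : NonZero n
    n-nonZero = double-nonZero m

  e : Fin n → ℕ
  e = alt n a b

  V : ℕ → ℕ
  V = vertex n e

  A B D : ℤ
  A = + a
  B = + b
  D = A + B

  b<n : b < n
  b<n = ≤∸1⇒< b≤n-1

  a<n : a < n
  a<n = ℕₚ.<-trans a<b b<n

  1≤b : 1 ≤ b
  1≤b = ℕₚ.≤-trans 1≤a (ℕₚ.<⇒≤ a<b)

  0<n : 0 < n
  0<n = ℕ.>-nonZero⁻¹ n

  1<n : 1 < n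
  1<n = double-mono-< (ℕ.>-nonZero⁻¹ m)

  entry-alt : ∀ {k} → k < n → entry e k ≡ altEntry a b k
  entry-alt {k} k<n with k ℕ.<? n
  ... | yes k<n′ = cong (altEntry a b) (toℕ-fromℕ< k<n′)
  ... | no k≮n   = contradiction k<n k≮n

  psum-even : ∀ q → double q ≤ n → psum e (double q) ≡ q ℕ.* (a ℕ.+ b)
  psum-odd  : ∀ q → suc (double q) ≤ n → psum e (suc (double q)) ≡ q ℕ.* (a ℕ.+ b) ℕ.+ a
  psum-even zero    _        = refl
  psum-even (suc q) 2q+2≤n = begin
    psum e (suc (double q)) ℕ.+ entry e (suc (double q))
      ≡⟨ cong₂ ℕ._+_ (psum-odd q (ℕₚ.<⇒≤ 2q+2≤n)) (trans (entry-alt 2q+2≤n) (altEntry-odd a b q)) ⟩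
    q ℕ.* (a ℕ.+ b) ℕ.+ a ℕ.+ b
      ≡⟨ ℕₚ.+-assoc (q ℕ.* (a ℕ.+ b)) a b ⟩
    q ℕ.* (a ℕ.+ b) ℕ.+ (a ℕ.+ b)
      ≡⟨ ℕₚ.+-comm (q ℕ.* (a ℕ.+ b)) (a ℕ.+ b) ⟩
    suc q ℕ.* (a ℕ.+ b)
      ∎
    where open ≡-Reasoning
  psum-odd q 2q+1≤n =
    cong₂ ℕ._+_ (psum-even q (ℕₚ.<⇒≤ 2q+1≤n)) (trans (entry-alt 2q+1≤n) (altEntry-even a b q))

  vertex-even : ∀ q → double q ≤ n → + V (double q) ≡ + q * D mod n
  vertex-even q 2q≤n = ≡mod-trans (%-≡mod (psum e (double q)))
    (≡mod-reflexive (trans (cong +_ (psum-even q 2q≤n)) (ℤₚ.pos-* q (a ℕ.+ b))))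

  vertex-odd : ∀ q → suc (double q) ≤ n → + V (suc (double q)) ≡ + q * D + A mod n
  vertex-odd q 2q+1≤n = ≡mod-trans (%-≡mod (psum e (suc (double q))))
    (≡mod-reflexive (trans (cong +_ (psum-odd q 2q+1≤n))
                           (trans (ℤₚ.pos-+ (q ℕ.* (a ℕ.+ b)) a) (cong (_+ A) (ℤₚ.pos-* q (a ℕ.+ b))))))

  V₀≡0 : + V 0 ≡ 0ℤ mod n
  V₀≡0 = vertex-even 0 z≤n

  V₁≡A : + V 1 ≡ A mod n
  V₁≡A = vertex-odd 0 (ℕₚ.<⇒≤ 1<n)

  V₂≡D : + V 2 ≡ D mod n
  V₂≡D = ≡mod-trans (vertex-even 1 1<n) (≡mod-reflexive (ℤₚ.*-identityˡ D))

  EvenEdge OddEdge : ℤ → ℕ → Set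
  EvenEdge l k = + V k ≡ l * D mod n × + V (suc k) ≡ l * D + A mod n
  OddEdge  l k = + V k ≡ l * D + A mod n × + V (suc k) ≡ l * D + D mod n

  vertex-even-suc : ∀ q → double (suc q) ≤ n → + V (double (suc q)) ≡ + q * D + D mod n
  vertex-even-suc q 2q+2≤n =
    ≡mod-trans (vertex-even (suc q) 2q+2≤n) (≡mod-reflexive (trans (ℤₚ.suc-* (+ q) D) (ℤₚ.+-comm D (+ q * D))))

  edge-shape : ∀ {k} → k < n → Σ ℤ λ l → EvenEdge l k ⊎ OddEdge l k
  edge-shape {k} k<n with parity k
  ... | even q = + q , inj₁ (vertex-even q (ℕₚ.<⇒≤ k<n) , vertex-odd q k<n)
  ... | odd q  = + q , inj₂ (vertex-odd q (ℕₚ.<⇒≤ k<n) , vertex-even-suc q k<n)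

  data IsEdge (P Q : ℤ) : Set where
    even-forward  : ∀ l → P ≡ l * D mod n     → Q ≡ l * D + A mod n → IsEdge P Q
    even-backward : ∀ l → P ≡ l * D + A mod n → Q ≡ l * D mod n     → IsEdge P Q
    odd-forward   : ∀ l → P ≡ l * D + A mod n → Q ≡ l * D + D mod n → IsEdge P Q
    odd-backward  : ∀ l → P ≡ l * D + D mod n → Q ≡ l * D + A mod n → IsEdge P Q

  reflected-vertex : ∀ c i {X} → + V i ≡ X mod n → + reflect n e c (V i) ≡ + c - X mod n
  reflected-vertex c i Vi≡X =
    ≡mod-trans (reflect-≡mod n e c (ℕₚ.<⇒≤ (vertex<n n e i))) (-‿cong-mod (≡mod-refl {x = + c}) Vi≡X)

  reflected-edge : ∀ {c} → IsAxis n e c → ∀ {k X Y} → k < n →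
    + V k ≡ X mod n → + V (suc k) ≡ Y mod n → IsEdge (+ toℕ c - X) (+ toℕ c - Y)
  reflected-edge {c} axis {k} k<n Vk≡X Vk+1≡Y with axis-at n e axis k<n
  ... | k′ , same = classify (edge-shape (toℕ<n k′))
    where
    P≡ = reflected-vertex (toℕ c) k Vk≡X
    Q≡ = reflected-vertex (toℕ c) (suc k) Vk+1≡Y
    classify : Σ ℤ (λ l → EvenEdge l (toℕ k′) ⊎ OddEdge l (toℕ k′)) → IsEdge _ _
    classify (l , inj₁ (Vk′≡ , Vk′+1≡)) =
      [ uncurry (even-forward l) , uncurry (even-backward l) ]′ (sameEdge-≡mod n e same P≡ Q≡ Vk′≡ Vk′+1≡)
    classify (l , inj₂ (Vk′≡ , Vk′+1≡)) =
      [ uncurry (odd-forward l) , uncurry (odd-backward l) ]′ (sameEdge-≡mod n e same P≡ Q≡ Vk′≡ Vk′+1≡)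

  a≢b-mod : ¬ (A ≡ B mod n)
  a≢b-mod A≡B = ℕₚ.<⇒≢ a<b (≡mod⇒≡ a<n b<n A≡B)

  data Position : ℕ → Set where
    even : ∀ {q} → q < m → + V (double q) ≡ + q * D mod n → Position (double q)
    odd  : ∀ {q} → q < m → + V (suc (double q)) ≡ + q * D + A mod n → Position (suc (double q))

  position : ∀ {k} → k < n → Position k
  position {k} k<n with parity k
  ... | even q = even (double-cancel-< k<n) (vertex-even q (ℕₚ.<⇒≤ k<n))
  ... | odd q  = odd (double-cancel-< (ℕₚ.<-trans (ℕₚ.n<1+n _) k<n)) (vertex-odd q (ℕₚ.<⇒≤ k<n))

  module _ (ret : FirstReturnAtEnd n e) where

    vertex≢0 : ∀ {i} → 1 ≤ i → i < n → ¬ (+ V i ≡ 0ℤ mod n)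
    vertex≢0 {i} 1≤i i<n Vᵢ≡0 = proj₁ ret i 1≤i (<⇒≤∸1 i<n) (≡mod⇒≡ (vertex<n n e i) 0<n Vᵢ≡0)

    mD≡0 : + m * D ≡ 0ℤ mod n
    mD≡0 = ≡mod-trans (≡mod-sym (vertex-even m ℕₚ.≤-refl)) (≡mod-reflexive (cong +_ (proj₂ ret)))

    multiple≢0 : ∀ {q} → 1 ≤ q → q < m → ¬ (+ q * D ≡ 0ℤ mod n)
    multiple≢0 {suc q} _ q<m qD≡0 =
      vertex≢0 (s≤s z≤n) 2q<n (≡mod-trans (vertex-even (suc q) (ℕₚ.<⇒≤ 2q<n)) qD≡0)
      where
      2q<n : double (suc q) < n
      2q<n = ℕₚ.<-trans (ℕₚ.n<1+n _) (double-mono-< q<m)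

    *D-mod-m : ∀ l → + (l %ℕ m) * D ≡ l * D mod n
    *D-mod-m l = ≡mod-scale mD≡0 (%ℕ-≡mod l)

    lD+A≢0 : ∀ l → ¬ (l * D + A ≡ 0ℤ mod n)
    lD+A≢0 l lD+A≡0 = vertex≢0 (s≤s z≤n) (double-mono-< q<m) (begin
      + V (suc (double q))   ≈⟨ vertex-odd q (ℕₚ.<⇒≤ (double-mono-< q<m)) ⟩
      + q * D + A            ≈⟨ +-cong-mod (*D-mod-m l) (≡mod-refl {x = A}) ⟩
      l * D + A              ≈⟨ lD+A≡0 ⟩
      0ℤ                     ∎)
      where
      open ≡mod-Reasoning n
      q = l %ℕ m
      q<m = n%ℕd<d l m

    kD≡0⇒k≡0 : ∀ {k} → k * D ≡ 0ℤ mod n → k ≡ 0ℤ mod m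
    kD≡0⇒k≡0 {k} kD≡0 =
      ≡mod-trans (≡mod-sym (%ℕ-≡mod k)) (small-order (n%ℕd<d k m) (≡mod-trans (*D-mod-m k) kD≡0))
      where
      small-order : ∀ {r} → r < m → + r * D ≡ 0ℤ mod n → + r ≡ 0ℤ mod m
      small-order {zero}  _   _     = ≡mod-refl
      small-order {suc r} r<m rD≡0 = contradiction rD≡0 (multiple≢0 (s≤s z≤n) r<m)

    multiple-injective : ∀ {p q} → p < m → q < m → + p * D ≡ + q * D mod n → p ≡ q
    multiple-injective {p} {q} p<m q<m pD≡qD = ≡mod⇒≡ p<m q<m (x-y≡0⇒x≡y-mod (kD≡0⇒k≡0
      (≡mod-trans (≡mod-reflexive (distrib (+ p) (+ q) D)) (x≡y⇒x-y≡0-mod pD≡qD))))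
      where
      distrib : ∀ p q d → (p - q) * d ≡ p * d - q * d
      distrib p q d = solve (p ∷ q ∷ d ∷ [])

    vertex-injective : ∀ {x y} → x < n → y < n → V x ≡ V y → x ≡ y
    vertex-injective x<n y<n Vx≡Vy = go (position x<n) (position y<n) (≡mod-reflexive (cong +_ Vx≡Vy))
      where
      shift : ∀ p q d a → (q - p) * d + a ≡ (q * d + a) - p * d
      shift p q d a = solve (p ∷ q ∷ d ∷ a ∷ [])

      go : ∀ {x y} → Position x → Position y → + V x ≡ + V y mod n → x ≡ y
      go (even p<m Vx≡) (even q<m Vy≡) Vx≡Vy = cong double (multiple-injective p<m q<m
        (≡mod-trans (≡mod-sym Vx≡) (≡mod-trans Vx≡Vy Vy≡)))
      go (odd p<m Vx≡) (odd q<m Vy≡) Vx≡Vy = cong (λ q → suc (double q)) (multiple-injective p<m q<m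
        (+-cancelʳ-mod A (≡mod-trans (≡mod-sym Vx≡) (≡mod-trans Vx≡Vy Vy≡))))
      go (even {p} _ Vx≡) (odd {q} _ Vy≡) Vx≡Vy = contradiction
        (≡mod-trans (≡mod-reflexive (shift (+ p) (+ q) D A)) (x≡y⇒x-y≡0-mod
          (≡mod-trans (≡mod-sym Vy≡) (≡mod-trans (≡mod-sym Vx≡Vy) Vx≡))))
        (lD+A≢0 (+ q - + p))
      go (odd {p} _ Vx≡) (even {q} _ Vy≡) Vx≡Vy = contradiction
        (≡mod-trans (≡mod-reflexive (shift (+ q) (+ p) D A)) (x≡y⇒x-y≡0-mod
          (≡mod-trans (≡mod-sym Vx≡) (≡mod-trans Vx≡Vy Vy≡))))
        (lD+A≢0 (+ p - + q))

    represents : Represents n e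
    represents = (λ i → altEntry-elim (λ x → 1 ≤ x × x ≤ n ∸ 1) (1≤a , a≤n-1) (1≤b , b≤n-1) (toℕ i))
               , (λ i j Vi≡Vj → toℕ-injective (vertex-injective (toℕ<n i) (toℕ<n j) Vi≡Vj))
               , proj₂ ret
      where
      a≤n-1 = ℕₚ.≤-trans (ℕₚ.<⇒≤ a<b) b≤n-1

    even-edge : ∀ l → Σ (Fin n) λ k → EvenEdge l (toℕ k)
    even-edge l = fromℕ< 2q<n , subst (EvenEdge l) (sym (toℕ-fromℕ< 2q<n))
      ( ≡mod-trans (vertex-even q (ℕₚ.<⇒≤ 2q<n)) (*D-mod-m l)
      , ≡mod-trans (vertex-odd q 2q<n) (+-cong-mod (*D-mod-m l) (≡mod-refl {x = A})))
      where
      q = l %ℕ m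
      2q<n = ℕₚ.<-trans (ℕₚ.n<1+n _) (double-mono-< (n%ℕd<d l m))

    odd-edge : ∀ l → Σ (Fin n) λ k → OddEdge l (toℕ k)
    odd-edge l = fromℕ< 2q+1<n , subst (OddEdge l) (sym (toℕ-fromℕ< 2q+1<n))
      ( ≡mod-trans (vertex-odd q (ℕₚ.<⇒≤ 2q+1<n)) (+-cong-mod (*D-mod-m l) (≡mod-refl {x = A}))
      , ≡mod-trans (vertex-even-suc q 2q+1<n) (+-cong-mod (*D-mod-m l) (≡mod-refl {x = D})))
      where
      q = l %ℕ m
      2q+1<n = double-mono-< (n%ℕd<d l m)

    axis-from : ∀ (c : Fin n) l → + toℕ c ≡ l * D + A mod n → IsAxis n e c
    axis-from c l C≡ k = mirror (edge-shape (toℕ<n k))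
      where
      image : ∀ i {X} → + V i ≡ X mod n → + reflect n e (toℕ c) (V i) ≡ (l * D + A) - X mod n
      image i {X} Vi≡X = ≡mod-trans (reflected-vertex (toℕ c) i Vi≡X) (-‿cong-mod C≡ (≡mod-refl {x = X}))

      Mirror : Set
      Mirror = Σ (Fin n) λ k′ → MirrorsSide n e (toℕ c) (toℕ k) (toℕ k′)

      reversed : ∀ {X Y} (k′ : Fin n) → + V (toℕ k) ≡ X mod n → + V (suc (toℕ k)) ≡ Y mod n →
        (l * D + A) - X ≡ + V (suc (toℕ k′)) mod n → (l * D + A) - Y ≡ + V (toℕ k′) mod n → Mirror
      reversed k′ Vk≡X Vk+1≡Y x≡ y≡ = k′ , sameEdge-reversed n e
        (reflect<n n e (toℕ c) (V (toℕ k))) (reflect<n n e (toℕ c) (V (suc (toℕ k))))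
        (vertex<n n e (toℕ k′)) (vertex<n n e (suc (toℕ k′)))
        (≡mod-trans (image (toℕ k) Vk≡X) x≡) (≡mod-trans (image (suc (toℕ k)) Vk+1≡Y) y≡)

      even-x : ∀ l l′ D A → (l * D + A) - l′ * D ≡ (l - l′) * D + A
      even-x l l′ D A = solve (l ∷ l′ ∷ D ∷ A ∷ [])
      even-y : ∀ l l′ D A → (l * D + A) - (l′ * D + A) ≡ (l - l′) * D
      even-y l l′ D A = solve (l ∷ l′ ∷ D ∷ A ∷ [])
      odd-x : ∀ l l′ D A → (l * D + A) - (l′ * D + A) ≡ (l - l′ - 1ℤ) * D + D
      odd-x l l′ D A = solve (l ∷ l′ ∷ D ∷ A ∷ [])
      odd-y : ∀ l l′ D A → (l * D + A) - (l′ * D + D) ≡ (l - l′ - 1ℤ) * D + A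
      odd-y l l′ D A = solve (l ∷ l′ ∷ D ∷ A ∷ [])

      mirror : Σ ℤ (λ l′ → EvenEdge l′ (toℕ k) ⊎ OddEdge l′ (toℕ k)) → Mirror
      mirror (l′ , inj₁ (Vk≡ , Vk+1≡)) = reversed k′ Vk≡ Vk+1≡
        (≡mod-trans (≡mod-reflexive (even-x l l′ D A)) (≡mod-sym (proj₂ Vk′≡)))
        (≡mod-trans (≡mod-reflexive (even-y l l′ D A)) (≡mod-sym (proj₁ Vk′≡)))
        where
        k′ = proj₁ (even-edge (l - l′))
        Vk′≡ = proj₂ (even-edge (l - l′))
      mirror (l′ , inj₂ (Vk≡ , Vk+1≡)) = reversed k′ Vk≡ Vk+1≡
        (≡mod-trans (≡mod-reflexive (odd-x l l′ D A)) (≡mod-sym (proj₂ Vk′≡)))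
        (≡mod-trans (≡mod-reflexive (odd-y l l′ D A)) (≡mod-sym (proj₁ Vk′≡)))
        where
        k′ = proj₁ (odd-edge (l - l′ - 1ℤ))
        Vk′≡ = proj₂ (odd-edge (l - l′ - 1ℤ))

    module _ {c : Fin n} (axis : IsAxis n e c) where
      open ≡mod-Reasoning n

      private
        C : ℤ
        C = + toℕ c

      reflected-difference : ∀ X Y {U W} → C - X ≡ U mod n → C - Y ≡ W mod n → Y - X ≡ U - W mod n
      reflected-difference X Y C-X≡U C-Y≡W =
        ≡mod-trans (≡mod-reflexive (sym ([x-y]-[x-z]≡z-y C X Y))) (-‿cong-mod C-X≡U C-Y≡W)

      no-axis-in-⟨D⟩ : ∀ l → C - 0ℤ ≡ l * D mod n → A + A ≡ 0ℤ mod n → IsEdge (C - A) (C - D) → ⊥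
      no-axis-in-⟨D⟩ l _ 2A≡0 (even-forward l′ P≡ Q≡) = a≢b-mod (≡mod-sym (begin
        B                        ≡⟨ [x+y]-x≡y A B ⟨
        D - A                    ≈⟨ reflected-difference A D P≡ Q≡ ⟩
        l′ * D - (l′ * D + A)    ≡⟨ x-[x+y]≡-y (l′ * D) A ⟩
        - A                      ≈⟨ x+x≡0⇒x≡-x-mod 2A≡0 ⟨
        A                        ∎))
      no-axis-in-⟨D⟩ l _ 2A≡0 (even-backward l′ P≡ Q≡) = a≢b-mod (≡mod-sym (begin
        B                        ≡⟨ [x+y]-x≡y A B ⟨
        D - A                    ≈⟨ reflected-difference A D P≡ Q≡ ⟩
        (l′ * D + A) - l′ * D    ≡⟨ [x+y]-x≡y (l′ * D) A ⟩
        A                        ∎))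
      no-axis-in-⟨D⟩ l _ 2A≡0 (odd-forward l′ P≡ Q≡) =
        ℕₚ.<⇒≢ (ℕₚ.+-mono-< a<b a<b) (trans a+a≡n (sym b+b≡n))
        where
        2B≡0 : B + B ≡ 0ℤ mod n
        2B≡0 = x≡-x⇒x+x≡0-mod (begin
          B                                  ≡⟨ [x+y]-x≡y A B ⟨
          D - A                              ≈⟨ reflected-difference A D P≡ Q≡ ⟩
          (l′ * D + A) - (l′ * D + D)        ≡⟨ [x+y]-[x+z]≡y-z (l′ * D) A D ⟩
          A - (A + B)                        ≡⟨ x-[x+y]≡-y A B ⟩
          - B                                ∎)
        a+a≡n = x+x≡0-mod⇒x+x≡n 1≤a a<n 2A≡0
        b+b≡n = x+x≡0-mod⇒x+x≡n 1≤b b<n 2B≡0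
      no-axis-in-⟨D⟩ l C≡lD _ (odd-backward l′ P≡ _) = lD+A≢0 k (begin
        k * D + A                            ≡⟨ cong (_+_ (k * D)) (ℤₚ.+-identityʳ A) ⟨
        k * D + (A - 0ℤ)                     ≈⟨ +-cong-mod (≡mod-refl {x = k * D}) (reflected-difference 0ℤ A C≡lD P≡) ⟩
        k * D + (l * D - (l′ * D + D))       ≡⟨ cancel l l′ D ⟩
        0ℤ                                   ∎)
        where
        k = l′ + 1ℤ - l
        cancel : ∀ l l′ D → (l′ + 1ℤ - l) * D + (l * D - (l′ * D + D)) ≡ 0ℤ
        cancel l l′ D = solve (l ∷ l′ ∷ D ∷ [])

      axis⇒ : Σ ℤ λ l → C ≡ l * D + A mod n
      axis⇒ = from-side₀ (reflected-edge axis {0} 0<n V₀≡0 V₁≡A)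
        where
        C≡C-0 : C ≡ C - 0ℤ mod n
        C≡C-0 = ≡mod-reflexive (sym (ℤₚ.+-identityʳ C))

        from-side₀ : IsEdge (C - 0ℤ) (C - A) → Σ ℤ λ l → C ≡ l * D + A mod n
        from-side₀ (even-forward l P≡ Q≡) =
          ⊥-elim (no-axis-in-⟨D⟩ l P≡ 2A≡0 (reflected-edge axis {1} 1<n V₁≡A V₂≡D))
          where
          2A≡0 : A + A ≡ 0ℤ mod n
          2A≡0 = x≡-x⇒x+x≡0-mod (begin
            A                        ≡⟨ ℤₚ.+-identityʳ A ⟨
            A - 0ℤ                   ≈⟨ reflected-difference 0ℤ A P≡ Q≡ ⟩
            l * D - (l * D + A)      ≡⟨ x-[x+y]≡-y (l * D) A ⟩
            - A                      ∎)
        from-side₀ (even-backward l P≡ _) = l , ≡mod-trans C≡C-0 P≡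
        from-side₀ (odd-forward l P≡ _)   = l , ≡mod-trans C≡C-0 P≡
        from-side₀ (odd-backward l P≡ Q≡) = contradiction (begin
          A                                ≡⟨ ℤₚ.+-identityʳ A ⟨
          A - 0ℤ                           ≈⟨ reflected-difference 0ℤ A P≡ Q≡ ⟩
          (l * D + D) - (l * D + A)        ≡⟨ [x+y]-[x+z]≡y-z (l * D) D A ⟩
          D - A                            ≡⟨ [x+y]-x≡y A B ⟩
          B                                ∎) a≢b-mod

    nthAxis : Fin m → Fin n
    nthAxis j = fromℕ< (vertex<n n e (suc (double (toℕ j))))

    nthAxis-≡mod : ∀ j → + toℕ (nthAxis j) ≡ + toℕ j * D + A mod n
    nthAxis-≡mod j = ≡mod-trans (≡mod-reflexive (cong +_ (toℕ-fromℕ< (vertex<n n e (suc (double (toℕ j)))))))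
                               (vertex-odd (toℕ j) (ℕₚ.<⇒≤ (double-mono-< (toℕ<n j))))

    nthAxis-injective : ∀ i j → nthAxis i ≡ nthAxis j → i ≡ j
    nthAxis-injective i j axisᵢ≡axisⱼ = toℕ-injective (double-injective (ℕₚ.suc-injective
      (vertex-injective (double-mono-< (toℕ<n i)) (double-mono-< (toℕ<n j)) (begin
        V (suc (double (toℕ i)))   ≡⟨ toℕ-fromℕ< (vertex<n n e (suc (double (toℕ i)))) ⟨
        toℕ (nthAxis i)            ≡⟨ cong toℕ axisᵢ≡axisⱼ ⟩
        toℕ (nthAxis j)            ≡⟨ toℕ-fromℕ< (vertex<n n e (suc (double (toℕ j)))) ⟩
        V (suc (double (toℕ j)))   ∎))))
      where open ≡-Reasoning

    isAxis⇔nthAxis : ∀ c → IsAxis n e c ⇔ Σ (Fin m) λ j → nthAxis j ≡ c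
    isAxis⇔nthAxis c = mk⇔ (λ axis → nthAxis-of (axis⇒ axis))
                           λ { (j , refl) → axis-from (nthAxis j) (+ toℕ j) (nthAxis-≡mod j) }
      where
      nthAxis-of : (Σ ℤ λ l → + toℕ c ≡ l * D + A mod n) → Σ (Fin m) λ j → nthAxis j ≡ c
      nthAxis-of (l , C≡) = j , toℕ-injective (≡mod⇒≡ (toℕ<n (nthAxis j)) (toℕ<n c) (begin
        + toℕ (nthAxis j)     ≈⟨ nthAxis-≡mod j ⟩
        + toℕ j * D + A      ≡⟨ cong (λ i → + i * D + A) (toℕ-fromℕ< q<m) ⟩
        + q * D + A          ≈⟨ +-cong-mod (*D-mod-m l) (≡mod-refl {x = A}) ⟩
        l * D + A            ≈⟨ C≡ ⟨
        + toℕ c              ∎))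
        where
        open ≡mod-Reasoning n
        q = l %ℕ m
        q<m = n%ℕd<d l m
        j = fromℕ< q<m

    hasExactlyAxes : HasExactlyAxes n e m
    hasExactlyAxes = nthAxis , nthAxis-injective , isAxis⇔nthAxis

  represents×axes⇔firstReturnAtEnd : (Represents n e × HasExactlyAxes n e m) ⇔ FirstReturnAtEnd n e
  represents×axes⇔firstReturnAtEnd = mk⇔ (λ (polygon , _) → represents⇒firstReturnAtEnd n e polygon)
    λ ret → represents ret , hasExactlyAxes ret

open import Data.Nat using (_*_)

theorem2 : (m n : ℕ) .{{_ : NonZero n}} → n ≡ 2 * m → 3 < n →
    (a b : ℕ) → 1 ≤ a → a < b → b ≤ n ∸ 1 →
    ((Represents n (alt n a b) × HasExactlyAxes n (alt n a b) m) ⇔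
    ((∀ i → 1 ≤ i → i ≤ n ∸ 1 → psum (alt n a b) i % n ≢ 0) × psum (alt n a b) n % n ≡ 0))
theorem2 m n n≡2m _ a b 1≤a a<b b≤n-1 with trans n≡2m (sym (double≡2* m))
... | refl = AlternatingPolygon.represents×axes⇔firstReturnAtEnd m {{double-nonZero⁻¹ m}} a b 1≤a a<b b≤n-1
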